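{- Let $\mathbb{Z}_{(3)}=(\mathbb{Z}\setminus3\mathbb{Z})^{ -1}\mathbb{Z}\subset\mathbb{Q}$ and let $\Gamma$ be a $\mathbb{Z}_{(3)}$-lattice such that $(\gamma,\gamma)\in\mathbb{Z}_{(3)}$ for all $\gamma\in\Gamma$. Let $\Gamma^{(t)}:=\{\alpha\in\Gamma\mid(\alpha,\alpha)\in3\mathbb{Z}_{(3)}\}$. Assume that $(\alpha,\beta)^2-(\alpha,\alpha)(\beta,\beta)\in3\mathbb{Z}_{(3)}$ for all $\alpha,\beta\in\Gamma$. Then $\Gamma^{(t)}$ is a sublattice of $\Gamma$ and $[\Gamma:\Gamma^{(t)}]\in\{1,3\}$.
   Context: A $\mathbb{Z}_{(3)}$-lattice is a finitely generated $\mathbb{Z}_{(3)}$-submodule of a Euclidean space spanning it. -}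

module Defs where

open import Data.Nat using (ℕ; zero; suc)
open import Data.Nat.Divisibility using (_∣_)
open import Data.Fin using (Fin; zero; suc)
open import Data.Product using (Σ; _×_; ∃)
open import Data.Empty using (⊥)
open import Relation.Nullary using (¬_)
open import Relation.Binary.PropositionalEquality using (_≡_)
open import Data.Rational using (ℚ; 0ℚ; 1ℚ; _+_; _*_; _-_; _<_)
open ℚ using (denominatorℕ)

InZ₍₃₎ : ℚ → Set
InZ₍₃₎ q = ¬ (3 ∣ denominatorℕ q)

three : ℚ
three = 1ℚ + 1ℚ + 1ℚ

In3Z₍₃₎ : ℚ → Set
In3Z₍₃₎ q = Σ ℚ (λ r → InZ₍₃₎ r × q ≡ three * r)

∑ : (n : ℕ) → (Fin n → ℚ) → ℚ
∑ zero    f = 0ℚ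
∑ (suc n) f = f zero + ∑ n (λ i → f (suc i))

-- Vectors in ℚ^n (coordinates with respect to a basis of the lattice).
Vecℚ : ℕ → Set
Vecℚ n = Fin n → ℚ

_⊕_ : {n : ℕ} → Vecℚ n → Vecℚ n → Vecℚ n
(x ⊕ y) i = x i + y i

_⊖_ : {n : ℕ} → Vecℚ n → Vecℚ n → Vecℚ n
(x ⊖ y) i = x i - y i

_·_ : {n : ℕ} → ℚ → Vecℚ n → Vecℚ n
(c · x) i = c * x i

𝟎 : {n : ℕ} → Vecℚ n
𝟎 i = 0ℚ

form : {n : ℕ} → (Fin n → Fin n → ℚ) → Vecℚ n → Vecℚ n → ℚ
form {n} G x y = ∑ n (λ i → ∑ n (λ j → x i * G i j * y j))

IsEuclideanGram : (n : ℕ) → (Fin n → Fin n → ℚ) → Set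
IsEuclideanGram n G =
  ((i j : Fin n) → G i j ≡ G j i) ×
  ((x : Vecℚ n) → ¬ (x ≡ 𝟎) → 0ℚ < form G x x)

InΓ : {n : ℕ} → Vecℚ n → Set
InΓ {n} x = (i : Fin n) → InZ₍₃₎ (x i)

InΓt : {n : ℕ} → (Fin n → Fin n → ℚ) → Vecℚ n → Set
InΓt G x = InΓ x × In3Z₍₃₎ (form G x x)

IsSubmoduleΓt : {n : ℕ} → (Fin n → Fin n → ℚ) → Set
IsSubmoduleΓt {n} G =
  InΓt G (𝟎 {n}) ×
  ((x y : Vecℚ n) → InΓt G x → InΓt G y → InΓt G (x ⊕ y)) ×
  ((c : ℚ) (x : Vecℚ n) → InZ₍₃₎ c → InΓt G x → InΓt G (c · x))

-- [Γ : Γ^(t)] = k : the quotient Γ/Γ^(t) has exactly k elements, i.e. there are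
-- k representatives in Γ, pairwise incongruent mod Γ^(t), covering all classes.
HasIndex : {n : ℕ} → (Fin n → Fin n → ℚ) → ℕ → Set
HasIndex {n} G k =
  Σ (Fin k → Vecℚ n) λ r →
    ((i : Fin k) → InΓ (r i)) ×
    ((x : Vecℚ n) → InΓ x → ∃ λ i → InΓt G (x ⊖ r i)) ×
    ((i j : Fin k) → InΓt G (r i ⊖ r j) → i ≡ j)

-- ℤ₍₃₎ is a local ring whose maximal ideal 3ℤ₍₃₎ is prime, with residue field 𝔽₃ (so every unit
-- squares to 1 modulo 3), and 2 is a unit in it. By polarisation the form is ℤ₍₃₎-valued on Γ, and
-- the hypothesis says (α,β)² ≡ (α,α)(β,β) mod 3. Hence (α,α) ≡ 0 forces (α,β) ≡ 0 for every β ∈ Γ,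
-- which makes Γ⁽ᵗ⁾ closed under addition, and makes Γ⁽ᵗ⁾ = Γ when every basis vector lies in Γ⁽ᵗ⁾.
-- Otherwise some basis vector α has unit norm q. For x ∈ Γ put c = (x,α)/q ∈ ℤ₍₃₎: then
-- (x − cα, x − cα) q = (x,x) q − (x,α)² ≡ 0, so x ≡ cα ≡ rα modulo Γ⁽ᵗ⁾ where r ∈ {0, 1, −1} is the
-- residue of c, and the three classes differ because (r − r′)² q is a unit whenever r ≠ r′.

module Submission where

open import Defs
open import Data.Nat as ℕ using (ℕ; zero; suc)
import Data.Nat.Divisibility as ℕ
import Data.Nat.Properties as ℕ
open import Data.Nat.Coprimality as Coprimality using (coprime-divisor)
open import Data.Nat.Primality using (euclidsLemma; prime?)
open import Data.Integer as ℤ using (ℤ; +_)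
import Data.Integer.Properties as ℤ
open import Data.Integer.Divisibility.Signed
  using (_∣_; _∣?_; divides; ∣ᵤ⇒∣; ∣⇒∣ᵤ; ∣m⇒∣m*n; ∣n⇒∣m*n; ∣m∣n⇒∣m-n; ∣-refl)
open import Data.Integer.DivMod using (_%ℕ_; _/ℕ_; a≡a%ℕn+[a/ℕn]*n; n%ℕd<d)
import Data.Integer.Solver as ℤ-Solver
open import Data.Rational as ℚ using (ℚ; mkℚ; 0ℚ; 1ℚ; ½; _+_; _*_; _-_; -_; 1/_; ↥_; ↧_)
import Data.Rational.Properties as ℚ
open import Data.Rational.Unnormalised using (*≡*)
import Data.Rational.Unnormalised.Properties as ℚᵘ
open import Data.Rational.Solver using (module +-*-Solver)
open import Data.Fin using (Fin; zero; suc)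
import Data.Fin.Properties as Fin
open import Data.Product using (∃; _×_; _,_)
open import Data.Sum as Sum using (_⊎_; inj₁; inj₂; [_,_]′)
open import Data.Empty using (⊥-elim)
open import Function using (_∘_; id)
open import Relation.Nullary using (¬_; Dec; yes; no; contradiction)
open import Relation.Nullary.Decidable using (from-yes; from-no; map′; _→-dec_)
open import Relation.Binary.PropositionalEquality
  using (_≡_; _≗_; refl; sym; trans; cong; cong₂; subst; module ≡-Reasoning)
open ≡-Reasoning

-- Integers and fractions in ℚ

ι : ℤ → ℚ
ι a = mkℚ a 0 (Coprimality.sym (Coprimality.1-coprimeTo ℤ.∣ a ∣))

ι-homo-+ : ∀ a b → ι (a ℤ.+ b) ≡ ι a + ι b
ι-homo-+ a b = ℚ.toℚᵘ-injective (ℚᵘ.≃-trans (*≡* cross) (ℚᵘ.≃-sym (ℚ.toℚᵘ-homo-+ (ι a) (ι b))))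
  where
  open ℤ-Solver.+-*-Solver
  cross : (a ℤ.+ b) ℤ.* + 1 ≡ (a ℤ.* + 1 ℤ.+ b ℤ.* + 1) ℤ.* + 1
  cross = solve 2 (λ a b → (a :+ b) :* con (+ 1) := (a :* con (+ 1) :+ b :* con (+ 1)) :* con (+ 1))
    refl a b

ι-homo-* : ∀ a b → ι (a ℤ.* b) ≡ ι a * ι b
ι-homo-* a b = ℚ.toℚᵘ-injective (ℚᵘ.≃-sym (ℚ.toℚᵘ-homo-* (ι a) (ι b)))

ι-homo-neg : ∀ a → ι (ℤ.- a) ≡ - ι a
ι-homo-neg a = ℚ.toℚᵘ-injective (ℚᵘ.≃-sym (ℚ.toℚᵘ-homo‿- (ι a)))

ι-homo-- : ∀ a b → ι (a ℤ.- b) ≡ ι a - ι b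
ι-homo-- a b = trans (ι-homo-+ a (ℤ.- b)) (cong (_+_ (ι a)) (ι-homo-neg b))

cross-multiply : ∀ q a b → q * ι b ≡ ι a → ↥ q ℤ.* b ≡ a ℤ.* ↧ q
cross-multiply q@(mkℚ _ d _) a b qb≡a
  with ℚᵘ.≃-trans (ℚᵘ.≃-sym (ℚ.toℚᵘ-homo-* q (ι b))) (ℚ.toℚᵘ-cong qb≡a)
... | *≡* cross = trans (sym (ℤ.*-identityʳ _)) (trans cross (cong (λ m → a ℤ.* + suc m) (ℕ.*-identityʳ d)))

*-↧≡↥ : ∀ q → q * ι (↧ q) ≡ ι (↥ q)
*-↧≡↥ q@(mkℚ n d _) = ℚ.toℚᵘ-injective (ℚᵘ.≃-trans (ℚ.toℚᵘ-homo-* q (ι (↧ q))) (*≡* cross))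
  where
  cross : n ℤ.* + suc d ℤ.* + 1 ≡ n ℤ.* + suc (d ℕ.* 1)
  cross = trans (ℤ.*-identityʳ _) (cong (λ m → n ℤ.* + suc m) (sym (ℕ.*-identityʳ d)))

+-fraction : ∀ p q → (p + q) * ι (↧ p ℤ.* ↧ q) ≡ ι (↥ p ℤ.* ↧ q ℤ.+ ↥ q ℤ.* ↧ p)
+-fraction p q = begin
  (p + q) * ι (↧ p ℤ.* ↧ q)
    ≡⟨ cong ((p + q) *_) (ι-homo-* (↧ p) (↧ q)) ⟩
  (p + q) * (ι (↧ p) * ι (↧ q))
    ≡⟨ solve 4 (λ p q x y → (p :+ q) :* (x :* y) := p :* x :* y :+ q :* y :* x)
         refl p q (ι (↧ p)) (ι (↧ q)) ⟩
  p * ι (↧ p) * ι (↧ q) + q * ι (↧ q) * ι (↧ p)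
    ≡⟨ cong₂ (λ x y → x * ι (↧ q) + y * ι (↧ p)) (*-↧≡↥ p) (*-↧≡↥ q) ⟩
  ι (↥ p) * ι (↧ q) + ι (↥ q) * ι (↧ p)
    ≡⟨ sym (cong₂ _+_ (ι-homo-* (↥ p) (↧ q)) (ι-homo-* (↥ q) (↧ p))) ⟩
  ι (↥ p ℤ.* ↧ q) + ι (↥ q ℤ.* ↧ p)
    ≡⟨ sym (ι-homo-+ (↥ p ℤ.* ↧ q) (↥ q ℤ.* ↧ p)) ⟩
  ι (↥ p ℤ.* ↧ q ℤ.+ ↥ q ℤ.* ↧ p) ∎
  where open +-*-Solver

*-fraction : ∀ p q → p * q * ι (↧ p ℤ.* ↧ q) ≡ ι (↥ p ℤ.* ↥ q)
*-fraction p q = begin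
  p * q * ι (↧ p ℤ.* ↧ q)
    ≡⟨ cong (p * q *_) (ι-homo-* (↧ p) (↧ q)) ⟩
  p * q * (ι (↧ p) * ι (↧ q))
    ≡⟨ solve 4 (λ p q x y → p :* q :* (x :* y) := p :* x :* (q :* y)) refl p q (ι (↧ p)) (ι (↧ q)) ⟩
  p * ι (↧ p) * (q * ι (↧ q))
    ≡⟨ cong₂ _*_ (*-↧≡↥ p) (*-↧≡↥ q) ⟩
  ι (↥ p) * ι (↥ q)
    ≡⟨ sym (ι-homo-* (↥ p) (↥ q)) ⟩
  ι (↥ p ℤ.* ↥ q) ∎
  where open +-*-Solver

-- Divisibility by 3 in ℤ

infix 4 3∣_ 3∤_

3∣_ 3∤_ : ℤ → Set
3∣ a = + 3 ∣ a
3∤ a = ¬ 3∣ a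

3∣-euclid : ∀ a b → 3∣ a ℤ.* b → 3∣ a ⊎ 3∣ b
3∣-euclid a b 3∣ab = Sum.map ∣ᵤ⇒∣ ∣ᵤ⇒∣
  (euclidsLemma ℤ.∣ a ∣ ℤ.∣ b ∣ (from-yes (prime? 3)) (subst (3 ℕ.∣_) (ℤ.abs-* a b) (∣⇒∣ᵤ 3∣ab)))

3∤-* : ∀ {a b} → 3∤ a → 3∤ b → 3∤ a ℤ.* b
3∤-* {a} {b} 3∤a 3∤b = [ 3∤a , 3∤b ]′ ∘ 3∣-euclid a b

3∣-cancelʳ : ∀ {a b} → 3∤ b → 3∣ a ℤ.* b → 3∣ a
3∣-cancelʳ {a} {b} 3∤b = [ id , ⊥-elim ∘ 3∤b ]′ ∘ 3∣-euclid a b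

3∣-cross : ∀ {m b a d} → 3∤ d → m ℤ.* b ≡ a ℤ.* d → 3∣ m → 3∣ a
3∣-cross {b = b} 3∤d mb≡ad 3∣m = 3∣-cancelʳ 3∤d (subst 3∣_ mb≡ad (∣m⇒∣m*n b 3∣m))

3∤⇒3∣sq-1 : ∀ a → 3∤ a → 3∣ a ℤ.* a ℤ.- + 1
3∤⇒3∣sq-1 a 3∤a = subst 3∣_ [a-1][a+1]≡a²-1 3∣[a-1][a+1]
  where
  open ℤ-Solver.+-*-Solver
  [a-1][a+1]≡a²-1 : (a ℤ.- + 1) ℤ.* (a ℤ.+ + 1) ≡ a ℤ.* a ℤ.- + 1
  [a-1][a+1]≡a²-1 = solve 1 (λ a → (a :- con (+ 1)) :* (a :+ con (+ 1)) := a :* a :- con (+ 1)) refl a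
  3∣[a-1][a+1] : 3∣ (a ℤ.- + 1) ℤ.* (a ℤ.+ + 1)
  3∣[a-1][a+1] with a %ℕ 3 | n%ℕd<d a 3 | a≡a%ℕn+[a/ℕn]*n a 3
  ... | 0 | _ | a≡3k = contradiction (divides (a /ℕ 3) (trans a≡3k (ℤ.+-identityˡ _))) 3∤a
  ... | 1 | _ | a≡1+3k = ∣m⇒∣m*n (a ℤ.+ + 1) (divides (a /ℕ 3) (trans (cong (ℤ._- + 1) a≡1+3k)
    (solve 1 (λ k → con (+ 1) :+ k :* con (+ 3) :- con (+ 1) := k :* con (+ 3)) refl (a /ℕ 3))))
  ... | 2 | _ | a≡2+3k = ∣n⇒∣m*n (a ℤ.- + 1) (divides (a /ℕ 3 ℤ.+ + 1) (trans (cong (ℤ._+ + 1) a≡2+3k)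
    (solve 1 (λ k → con (+ 2) :+ k :* con (+ 3) :+ con (+ 1) := (k :+ con (+ 1)) :* con (+ 3))
      refl (a /ℕ 3))))
  ... | suc (suc (suc _)) | ℕ.s≤s (ℕ.s≤s (ℕ.s≤s ())) | _

-- The local ring ℤ₍₃₎

InZ₍₃₎⇒3∤↧ : ∀ q → InZ₍₃₎ q → 3∤ ↧ q
InZ₍₃₎⇒3∤↧ q q∈Z 3∣↧q = q∈Z (∣⇒∣ᵤ 3∣↧q)

InZ₍₃₎-fraction : ∀ q {a b} → q * ι b ≡ ι a → 3∤ b → InZ₍₃₎ q
InZ₍₃₎-fraction q@(mkℚ n d coprime) {a} {b} qb≡a 3∤b 3∣↧q =
  3∤b (∣ᵤ⇒∣ (ℕ.∣-trans 3∣↧q (coprime-divisor (Coprimality.sym (Coprimality.recompute coprime)) ↧q∣nb)))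
  where
  ↧q∣nb : suc d ℕ.∣ ℤ.∣ n ∣ ℕ.* ℤ.∣ b ∣
  ↧q∣nb = ℕ.divides ℤ.∣ a ∣
    (trans (sym (ℤ.abs-* n b)) (trans (cong ℤ.∣_∣ (cross-multiply q a b qb≡a)) (ℤ.abs-* a (↧ q))))

InZ₍₃₎-ι : ∀ a → InZ₍₃₎ (ι a)
InZ₍₃₎-ι a 3∣1 with ℕ.∣1⇒≡1 3∣1
... | ()

InZ₍₃₎-0 : InZ₍₃₎ 0ℚ
InZ₍₃₎-0 = InZ₍₃₎-ι (+ 0)

InZ₍₃₎-1 : InZ₍₃₎ 1ℚ
InZ₍₃₎-1 = InZ₍₃₎-ι (+ 1)

InZ₍₃₎-½ : InZ₍₃₎ ½
InZ₍₃₎-½ = from-no (3 ℕ.∣? 2)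

InZ₍₃₎-neg : ∀ q → InZ₍₃₎ q → InZ₍₃₎ (- q)
InZ₍₃₎-neg q q∈Z = q∈Z ∘ subst (3 ℕ.∣_) (cong ℤ.∣_∣ (ℚ.↧-neg q))

InZ₍₃₎-+ : ∀ p q → InZ₍₃₎ p → InZ₍₃₎ q → InZ₍₃₎ (p + q)
InZ₍₃₎-+ p q p∈Z q∈Z =
  InZ₍₃₎-fraction (p + q) (+-fraction p q) (3∤-* (InZ₍₃₎⇒3∤↧ p p∈Z) (InZ₍₃₎⇒3∤↧ q q∈Z))

InZ₍₃₎-* : ∀ p q → InZ₍₃₎ p → InZ₍₃₎ q → InZ₍₃₎ (p * q)
InZ₍₃₎-* p q p∈Z q∈Z =
  InZ₍₃₎-fraction (p * q) (*-fraction p q) (3∤-* (InZ₍₃₎⇒3∤↧ p p∈Z) (InZ₍₃₎⇒3∤↧ q q∈Z))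

InZ₍₃₎-- : ∀ p q → InZ₍₃₎ p → InZ₍₃₎ q → InZ₍₃₎ (p - q)
InZ₍₃₎-- p q p∈Z q∈Z = InZ₍₃₎-+ p (- q) p∈Z (InZ₍₃₎-neg q q∈Z)

⅓ : ℚ
⅓ = + 1 ℚ./ 3

In3Z₍₃₎-fraction : ∀ q {a b} → q * ι b ≡ ι a → 3∤ b → 3∣ a → In3Z₍₃₎ q
In3Z₍₃₎-fraction q {b = b} qb≡3k 3∤b (divides k refl) =
  ⅓ * q , InZ₍₃₎-fraction (⅓ * q) ⅓qb≡k 3∤b , sym 3⅓q≡q
  where
  open +-*-Solver
  ⅓qb≡k : ⅓ * q * ι b ≡ ι k
  ⅓qb≡k = begin
    ⅓ * q * ι b         ≡⟨ ℚ.*-assoc ⅓ q (ι b) ⟩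
    ⅓ * (q * ι b)       ≡⟨ cong (⅓ *_) (trans qb≡3k (ι-homo-* k (+ 3))) ⟩
    ⅓ * (ι k * three)   ≡⟨ solve 3 (λ t k h → t :* (k :* h) := k :* (h :* t)) refl ⅓ (ι k) three ⟩
    ι k * (three * ⅓)   ≡⟨ ℚ.*-identityʳ (ι k) ⟩
    ι k                 ∎
  3⅓q≡q : three * (⅓ * q) ≡ q
  3⅓q≡q = trans (sym (ℚ.*-assoc three ⅓ q)) (ℚ.*-identityˡ q)

In3Z₍₃₎⇒InZ₍₃₎ : ∀ {q} → In3Z₍₃₎ q → InZ₍₃₎ q
In3Z₍₃₎⇒InZ₍₃₎ (r , r∈Z , refl) = InZ₍₃₎-* three r (InZ₍₃₎-ι (+ 3)) r∈Z

In3Z₍₃₎⇒3∣↥ : ∀ {q} → In3Z₍₃₎ q → 3∣ ↥ q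
In3Z₍₃₎⇒3∣↥ {q} (r , r∈Z , refl) =
  3∣-cross (InZ₍₃₎⇒3∤↧ r r∈Z) (sym (cross-multiply q _ (↧ r) 3r↧r≡3↥r)) (∣m⇒∣m*n (↥ r) ∣-refl)
  where
  3r↧r≡3↥r : three * r * ι (↧ r) ≡ ι (+ 3 ℤ.* ↥ r)
  3r↧r≡3↥r = begin
    three * r * ι (↧ r)    ≡⟨ ℚ.*-assoc three r (ι (↧ r)) ⟩
    three * (r * ι (↧ r))  ≡⟨ cong (three *_) (*-↧≡↥ r) ⟩
    ι (+ 3) * ι (↥ r)      ≡⟨ sym (ι-homo-* (+ 3) (↥ r)) ⟩
    ι (+ 3 ℤ.* ↥ r)        ∎

3∣↥⇒In3Z₍₃₎ : ∀ q → InZ₍₃₎ q → 3∣ ↥ q → In3Z₍₃₎ q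
3∣↥⇒In3Z₍₃₎ q q∈Z = In3Z₍₃₎-fraction q (*-↧≡↥ q) (InZ₍₃₎⇒3∤↧ q q∈Z)

In3Z₍₃₎? : ∀ q → InZ₍₃₎ q → Dec (In3Z₍₃₎ q)
In3Z₍₃₎? q q∈Z = map′ (3∣↥⇒In3Z₍₃₎ q q∈Z) In3Z₍₃₎⇒3∣↥ (+ 3 ∣? ↥ q)

In3Z₍₃₎-0 : In3Z₍₃₎ 0ℚ
In3Z₍₃₎-0 = 0ℚ , InZ₍₃₎-0 , refl

In3Z₍₃₎-+ : ∀ {p q} → In3Z₍₃₎ p → In3Z₍₃₎ q → In3Z₍₃₎ (p + q)
In3Z₍₃₎-+ (r , r∈Z , refl) (s , s∈Z , refl) =
  r + s , InZ₍₃₎-+ r s r∈Z s∈Z , sym (ℚ.*-distribˡ-+ three r s)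

In3Z₍₃₎-neg : ∀ {q} → In3Z₍₃₎ q → In3Z₍₃₎ (- q)
In3Z₍₃₎-neg (r , r∈Z , refl) = - r , InZ₍₃₎-neg r r∈Z , ℚ.neg-distribʳ-* three r

In3Z₍₃₎-*ˡ : ∀ c {q} → InZ₍₃₎ c → In3Z₍₃₎ q → In3Z₍₃₎ (c * q)
In3Z₍₃₎-*ˡ c c∈Z (r , r∈Z , refl) =
  c * r , InZ₍₃₎-* c r c∈Z r∈Z , solve 3 (λ c t r → c :* (t :* r) := t :* (c :* r)) refl c three r
  where open +-*-Solver

In3Z₍₃₎-*ʳ : ∀ c {q} → InZ₍₃₎ c → In3Z₍₃₎ q → In3Z₍₃₎ (q * c)
In3Z₍₃₎-*ʳ c {q} c∈Z q∈3Z = subst In3Z₍₃₎ (ℚ.*-comm c q) (In3Z₍₃₎-*ˡ c c∈Z q∈3Z)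

In3Z₍₃₎-prime : ∀ p q → InZ₍₃₎ p → InZ₍₃₎ q → In3Z₍₃₎ (p * q) → In3Z₍₃₎ p ⊎ In3Z₍₃₎ q
In3Z₍₃₎-prime p q p∈Z q∈Z pq∈3Z =
  Sum.map (3∣↥⇒In3Z₍₃₎ p p∈Z) (3∣↥⇒In3Z₍₃₎ q q∈Z) (3∣-euclid (↥ p) (↥ q) 3∣↥p↥q)
  where
  3∣↥p↥q : 3∣ ↥ p ℤ.* ↥ q
  3∣↥p↥q = 3∣-cross (InZ₍₃₎⇒3∤↧ (p * q) (InZ₍₃₎-* p q p∈Z q∈Z))
    (cross-multiply (p * q) _ _ (*-fraction p q)) (In3Z₍₃₎⇒3∣↥ pq∈3Z)

In3Z₍₃₎-sq : ∀ w → InZ₍₃₎ w → In3Z₍₃₎ (w * w) → In3Z₍₃₎ w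
In3Z₍₃₎-sq w w∈Z = [ id , id ]′ ∘ In3Z₍₃₎-prime w w w∈Z w∈Z

In3Z₍₃₎-cancelʳ : ∀ y u → InZ₍₃₎ y → InZ₍₃₎ u → ¬ In3Z₍₃₎ u → In3Z₍₃₎ (y * u) → In3Z₍₃₎ y
In3Z₍₃₎-cancelʳ y u y∈Z u∈Z u∉3Z = [ id , ⊥-elim ∘ u∉3Z ]′ ∘ In3Z₍₃₎-prime y u y∈Z u∈Z

In3Z₍₃₎-unit²-1 : ∀ u → InZ₍₃₎ u → ¬ In3Z₍₃₎ u → In3Z₍₃₎ (u * u - 1ℚ)
In3Z₍₃₎-unit²-1 u u∈Z u∉3Z = In3Z₍₃₎-fraction (u * u - 1ℚ) fraction (3∤-* 3∤d 3∤d) 3∣n²-d²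
  where
  n d : ℤ
  n = ↥ u
  d = ↧ u
  3∤n : 3∤ n
  3∤n = u∉3Z ∘ 3∣↥⇒In3Z₍₃₎ u u∈Z
  3∤d : 3∤ d
  3∤d = InZ₍₃₎⇒3∤↧ u u∈Z
  fraction : (u * u - 1ℚ) * ι (d ℤ.* d) ≡ ι (n ℤ.* n ℤ.- d ℤ.* d)
  fraction = begin
    (u * u - 1ℚ) * ι (d ℤ.* d)
      ≡⟨ solve 2 (λ p x → (p :- con 1ℚ) :* x := p :* x :- x) refl (u * u) (ι (d ℤ.* d)) ⟩
    u * u * ι (d ℤ.* d) - ι (d ℤ.* d)
      ≡⟨ cong (_- ι (d ℤ.* d)) (*-fraction u u) ⟩
    ι (n ℤ.* n) - ι (d ℤ.* d)
      ≡⟨ sym (ι-homo-- (n ℤ.* n) (d ℤ.* d)) ⟩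
    ι (n ℤ.* n ℤ.- d ℤ.* d) ∎
    where open +-*-Solver
  3∣n²-d² : 3∣ n ℤ.* n ℤ.- d ℤ.* d
  3∣n²-d² = subst 3∣_
    (solve 2 (λ n d → n :* n :- con (+ 1) :- (d :* d :- con (+ 1)) := n :* n :- d :* d) refl n d)
    (∣m∣n⇒∣m-n (3∤⇒3∣sq-1 n 3∤n) (3∤⇒3∣sq-1 d 3∤d))
    where open ℤ-Solver.+-*-Solver

InZ₍₃₎-inverse : ∀ q → InZ₍₃₎ q → ¬ In3Z₍₃₎ q → ∃ λ u → InZ₍₃₎ u × q * u ≡ 1ℚ
InZ₍₃₎-inverse q q∈Z q∉3Z =
  1/ q , InZ₍₃₎-fraction (1/ q) fraction (q∉3Z ∘ 3∣↥⇒In3Z₍₃₎ q q∈Z) , ℚ.*-inverseʳ q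
  where
  instance
    q≢0 : ℚ.NonZero q
    q≢0 = ℚ.≢-nonZero (λ q≡0 → q∉3Z (subst In3Z₍₃₎ (sym q≡0) In3Z₍₃₎-0))
  fraction : 1/ q * ι (↥ q) ≡ ι (↧ q)
  fraction = begin
    1/ q * ι (↥ q)         ≡⟨ cong (1/ q *_) (sym (*-↧≡↥ q)) ⟩
    1/ q * (q * ι (↧ q))   ≡⟨ sym (ℚ.*-assoc (1/ q) q (ι (↧ q))) ⟩
    1/ q * q * ι (↧ q)     ≡⟨ cong (_* ι (↧ q)) (ℚ.*-inverseˡ q) ⟩
    1ℚ * ι (↧ q)           ≡⟨ ℚ.*-identityˡ (ι (↧ q)) ⟩
    ι (↧ q)                ∎

residue₃ : Fin 3 → ℚ
residue₃ zero             = 0ℚ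
residue₃ (suc zero)       = 1ℚ
residue₃ (suc (suc zero)) = - 1ℚ

InZ₍₃₎-residue₃ : ∀ i → InZ₍₃₎ (residue₃ i)
InZ₍₃₎-residue₃ zero             = InZ₍₃₎-0
InZ₍₃₎-residue₃ (suc zero)       = InZ₍₃₎-1
InZ₍₃₎-residue₃ (suc (suc zero)) = InZ₍₃₎-neg 1ℚ InZ₍₃₎-1

residue₃-surjective : ∀ c → InZ₍₃₎ c → ∃ λ i → In3Z₍₃₎ (c - residue₃ i)
residue₃-surjective c c∈Z with In3Z₍₃₎? c c∈Z
... | yes c∈3Z = zero , subst In3Z₍₃₎ (solve 1 (λ c → c := c :- con 0ℚ) refl c) c∈3Z
  where open +-*-Solver
... | no c∉3Z = [ (suc zero ,_) , (suc (suc zero) ,_) ]′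
  (In3Z₍₃₎-prime (c - 1ℚ) (c - - 1ℚ)
    (InZ₍₃₎-- c 1ℚ c∈Z InZ₍₃₎-1) (InZ₍₃₎-- c (- 1ℚ) c∈Z (InZ₍₃₎-residue₃ (suc (suc zero))))
    (subst In3Z₍₃₎ (solve 1 (λ c → c :* c :- con 1ℚ := (c :- con 1ℚ) :* (c :- :- con 1ℚ)) refl c)
      (In3Z₍₃₎-unit²-1 c c∈Z c∉3Z)))
  where open +-*-Solver

residue₃-injective : ∀ i j → In3Z₍₃₎ (residue₃ i - residue₃ j) → i ≡ j
residue₃-injective i j = 3∣⇒≡ i j ∘ In3Z₍₃₎⇒3∣↥
  where
  3∣⇒≡ : ∀ i j → 3∣ ↥ (residue₃ i - residue₃ j) → i ≡ j
  3∣⇒≡ = from-yes (Fin.all? λ i → Fin.all? λ j → (+ 3 ∣? ↥ (residue₃ i - residue₃ j)) →-dec (i Fin.≟ j))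

-- Finite sums and bilinear forms

∑-cong : ∀ n {f g : Fin n → ℚ} → f ≗ g → ∑ n f ≡ ∑ n g
∑-cong zero    f≗g = refl
∑-cong (suc n) f≗g = cong₂ _+_ (f≗g zero) (∑-cong n (f≗g ∘ suc))

∑-0 : ∀ n → ∑ n (λ _ → 0ℚ) ≡ 0ℚ
∑-0 zero    = refl
∑-0 (suc n) = trans (ℚ.+-identityˡ _) (∑-0 n)

∑-+ : ∀ n (f g : Fin n → ℚ) → ∑ n (λ i → f i + g i) ≡ ∑ n f + ∑ n g
∑-+ zero    f g = refl
∑-+ (suc n) f g = begin
  f zero + g zero + ∑ n (λ i → f (suc i) + g (suc i))
    ≡⟨ cong (_+_ (f zero + g zero)) (∑-+ n (f ∘ suc) (g ∘ suc)) ⟩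
  f zero + g zero + (∑ n (f ∘ suc) + ∑ n (g ∘ suc))
    ≡⟨ solve 4 (λ a b c d → a :+ b :+ (c :+ d) := a :+ c :+ (b :+ d))
         refl (f zero) (g zero) (∑ n (f ∘ suc)) (∑ n (g ∘ suc)) ⟩
  f zero + ∑ n (f ∘ suc) + (g zero + ∑ n (g ∘ suc)) ∎
  where open +-*-Solver

∑-*ˡ : ∀ n c (f : Fin n → ℚ) → ∑ n (λ i → c * f i) ≡ c * ∑ n f
∑-*ˡ zero    c f = sym (ℚ.*-zeroʳ c)
∑-*ˡ (suc n) c f = trans (cong (_+_ (c * f zero)) (∑-*ˡ n c (f ∘ suc))) (sym (ℚ.*-distribˡ-+ c (f zero) _))

∑-swap : ∀ m n (f : Fin m → Fin n → ℚ) → ∑ m (λ i → ∑ n (f i)) ≡ ∑ n (λ j → ∑ m (λ i → f i j))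
∑-swap zero    n f = sym (∑-0 n)
∑-swap (suc m) n f = trans (cong (_+_ (∑ n (f zero))) (∑-swap m n (f ∘ suc))) (sym (∑-+ n (f zero) _))

In3Z₍₃₎-∑ : ∀ n (f : Fin n → ℚ) → (∀ i → In3Z₍₃₎ (f i)) → In3Z₍₃₎ (∑ n f)
In3Z₍₃₎-∑ zero    f f∈3Z = In3Z₍₃₎-0
In3Z₍₃₎-∑ (suc n) f f∈3Z = In3Z₍₃₎-+ (f∈3Z zero) (In3Z₍₃₎-∑ n (f ∘ suc) (f∈3Z ∘ suc))

basis : ∀ {n} → Fin n → Vecℚ n
basis zero    zero    = 1ℚ
basis zero    (suc _) = 0ℚ
basis (suc _) zero    = 0ℚ
basis (suc k) (suc i) = basis k i

∑-basisˡ : ∀ n k (f : Fin n → ℚ) → ∑ n (λ i → basis k i * f i) ≡ f k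
∑-basisˡ (suc n) zero    f = begin
  1ℚ * f zero + ∑ n (λ i → 0ℚ * f (suc i))  ≡⟨ cong₂ _+_ (ℚ.*-identityˡ (f zero)) (∑-*ˡ n 0ℚ (f ∘ suc)) ⟩
  f zero + 0ℚ * ∑ n (f ∘ suc)               ≡⟨ cong (_+_ (f zero)) (ℚ.*-zeroˡ (∑ n (f ∘ suc))) ⟩
  f zero + 0ℚ                               ≡⟨ ℚ.+-identityʳ (f zero) ⟩
  f zero                                    ∎
∑-basisˡ (suc n) (suc k) f =
  trans (cong₂ _+_ (ℚ.*-zeroˡ (f zero)) (∑-basisˡ n k (f ∘ suc))) (ℚ.+-identityˡ (f (suc k)))

∑-basisʳ : ∀ n k (f : Fin n → ℚ) → ∑ n (λ i → f i * basis k i) ≡ f k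
∑-basisʳ n k f = trans (∑-cong n (λ i → ℚ.*-comm (f i) (basis k i))) (∑-basisˡ n k f)

module _ {n : ℕ} where

  ∑² : (Fin n → Fin n → ℚ) → ℚ
  ∑² f = ∑ n (λ i → ∑ n (f i))

  ∑²-cong : ∀ {f g} → (∀ i j → f i j ≡ g i j) → ∑² f ≡ ∑² g
  ∑²-cong f≗g = ∑-cong n (λ i → ∑-cong n (f≗g i))

  ∑²-+ : ∀ {f g h} → (∀ i j → f i j ≡ g i j + h i j) → ∑² f ≡ ∑² g + ∑² h
  ∑²-+ {g = g} {h} f≗g+h =
    trans (∑-cong n (λ i → trans (∑-cong n (f≗g+h i)) (∑-+ n (g i) (h i)))) (∑-+ n _ _)

  ∑²-*ˡ : ∀ c {f g} → (∀ i j → f i j ≡ c * g i j) → ∑² f ≡ c * ∑² g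
  ∑²-*ˡ c {g = g} f≗cg =
    trans (∑-cong n (λ i → trans (∑-cong n (f≗cg i)) (∑-*ˡ n c (g i)))) (∑-*ˡ n c _)

module _ {n : ℕ} (G : Fin n → Fin n → ℚ) where

  open +-*-Solver

  form-cong : ∀ {x x′ y y′ : Vecℚ n} → x ≗ x′ → y ≗ y′ → form G x y ≡ form G x′ y′
  form-cong x≗x′ y≗y′ = ∑²-cong (λ i j → cong₂ (λ a b → a * G i j * b) (x≗x′ i) (y≗y′ j))

  form-⊕ˡ : ∀ (x y z : Vecℚ n) → form G (x ⊕ y) z ≡ form G x z + form G y z
  form-⊕ˡ x y z = ∑²-+ (λ i j →
    solve 4 (λ a b g c → (a :+ b) :* g :* c := a :* g :* c :+ b :* g :* c) refl (x i) (y i) (G i j) (z j))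

  form-⊕ʳ : ∀ (x y z : Vecℚ n) → form G x (y ⊕ z) ≡ form G x y + form G x z
  form-⊕ʳ x y z = ∑²-+ (λ i j →
    solve 4 (λ a g b c → a :* g :* (b :+ c) := a :* g :* b :+ a :* g :* c) refl (x i) (G i j) (y j) (z j))

  form-·ˡ : ∀ c (x y : Vecℚ n) → form G (c · x) y ≡ c * form G x y
  form-·ˡ c x y = ∑²-*ˡ c (λ i j →
    solve 4 (λ c a g b → c :* a :* g :* b := c :* (a :* g :* b)) refl c (x i) (G i j) (y j))

  form-·ʳ : ∀ c (x y : Vecℚ n) → form G x (c · y) ≡ c * form G x y
  form-·ʳ c x y = ∑²-*ˡ c (λ i j →
    solve 4 (λ c a g b → a :* g :* (c :* b) := c :* (a :* g :* b)) refl c (x i) (G i j) (y j))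

  form-·-· : ∀ c (x : Vecℚ n) → form G (c · x) (c · x) ≡ c * c * form G x x
  form-·-· c x = trans (form-·ˡ c x (c · x)) (trans (cong (c *_) (form-·ʳ c x x)) (sym (ℚ.*-assoc c c _)))

  form-𝟎ˡ : ∀ (y : Vecℚ n) → form G 𝟎 y ≡ 0ℚ
  form-𝟎ˡ y = begin
    form G 𝟎 y
      ≡⟨ ∑²-cong (λ i j → trans (cong (_* y j) (ℚ.*-zeroˡ (G i j))) (ℚ.*-zeroˡ (y j))) ⟩
    ∑ n (λ _ → ∑ n (λ _ → 0ℚ))
      ≡⟨ trans (∑-cong n (λ _ → ∑-0 n)) (∑-0 n) ⟩
    0ℚ ∎

  form-basis : ∀ k l → form G (basis k) (basis l) ≡ G k l
  form-basis k l =
    trans (∑-cong n (λ i → ∑-basisʳ n l (λ j → basis k i * G i j))) (∑-basisˡ n k (λ i → G i l))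

  module _ (G-sym : ∀ i j → G i j ≡ G j i) where

    form-sym : ∀ (x y : Vecℚ n) → form G x y ≡ form G y x
    form-sym x y = trans
      (∑²-cong (λ i j → trans (cong (λ g → x i * g * y j) (G-sym i j))
                              (solve 3 (λ a g b → a :* g :* b := b :* g :* a) refl (x i) (G j i) (y j))))
      (∑-swap n n (λ i j → y j * G j i * x i))

    form-⊕-⊕ : ∀ (x y : Vecℚ n) →
      form G (x ⊕ y) (x ⊕ y) ≡ form G x x + (form G x y + form G x y) + form G y y
    form-⊕-⊕ x y = begin
      form G (x ⊕ y) (x ⊕ y)
        ≡⟨ trans (form-⊕ˡ x y (x ⊕ y)) (cong₂ _+_ (form-⊕ʳ x x y) (form-⊕ʳ y x y)) ⟩
      form G x x + form G x y + (form G y x + form G y y)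
        ≡⟨ cong (λ b → form G x x + form G x y + (b + form G y y)) (form-sym y x) ⟩
      form G x x + form G x y + (form G x y + form G y y)
        ≡⟨ solve 3 (λ p b q → p :+ b :+ (b :+ q) := p :+ (b :+ b) :+ q)
             refl (form G x x) (form G x y) (form G y y) ⟩
      form G x x + (form G x y + form G x y) + form G y y ∎

    form-projection : ∀ (x α : Vecℚ n) c → c * form G α α ≡ form G x α →
      form G (x ⊖ (c · α)) (x ⊖ (c · α)) * form G α α ≡ form G x x * form G α α - form G x α * form G x α
    form-projection x α c cq≡b = begin
      form G (x ⊖ (c · α)) (x ⊖ (c · α)) * q
        ≡⟨ cong (_* q) (form-cong x-cα≗x+[-c]α x-cα≗x+[-c]α) ⟩
      form G (x ⊕ ((- c) · α)) (x ⊕ ((- c) · α)) * q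
        ≡⟨ cong (_* q) (form-⊕-⊕ x ((- c) · α)) ⟩
      (p + (form G x ((- c) · α) + form G x ((- c) · α)) + form G ((- c) · α) ((- c) · α)) * q
        ≡⟨ cong₂ (λ u v → (p + (u + u) + v) * q) (form-·ʳ (- c) x α) (form-·-· (- c) α) ⟩
      (p + (- c * b + - c * b) + - c * - c * q) * q
        ≡⟨ cong (λ b → (p + (- c * b + - c * b) + - c * - c * q) * q) (sym cq≡b) ⟩
      (p + (- c * (c * q) + - c * (c * q)) + - c * - c * q) * q
        ≡⟨ solve 3 (λ p c q → (p :+ (:- c :* (c :* q) :+ :- c :* (c :* q)) :+ :- c :* :- c :* q) :* q
                              := p :* q :- c :* q :* (c :* q)) refl p c q ⟩
      p * q - c * q * (c * q)
        ≡⟨ cong (λ b → p * q - b * b) cq≡b ⟩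
      p * q - b * b ∎
      where
      p q b : ℚ
      p = form G x x
      q = form G α α
      b = form G x α
      x-cα≗x+[-c]α : x ⊖ (c · α) ≗ x ⊕ ((- c) · α)
      x-cα≗x+[-c]α i = solve 3 (λ x c a → x :- c :* a := x :+ :- c :* a) refl (x i) c (α i)

-- The sublattice Γ⁽ᵗ⁾

module _ {n : ℕ} where

  InΓ-⊕ : ∀ (x y : Vecℚ n) → InΓ x → InΓ y → InΓ (x ⊕ y)
  InΓ-⊕ x y x∈Γ y∈Γ i = InZ₍₃₎-+ (x i) (y i) (x∈Γ i) (y∈Γ i)

  InΓ-⊖ : ∀ (x y : Vecℚ n) → InΓ x → InΓ y → InΓ (x ⊖ y)
  InΓ-⊖ x y x∈Γ y∈Γ i = InZ₍₃₎-- (x i) (y i) (x∈Γ i) (y∈Γ i)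

  InΓ-· : ∀ c (x : Vecℚ n) → InZ₍₃₎ c → InΓ x → InΓ (c · x)
  InΓ-· c x c∈Z x∈Γ i = InZ₍₃₎-* c (x i) c∈Z (x∈Γ i)

  InΓ-𝟎 : InΓ (𝟎 {n})
  InΓ-𝟎 _ = InZ₍₃₎-0

InΓ-basis : ∀ {n} (k : Fin n) → InΓ (basis k)
InΓ-basis zero    zero    = InZ₍₃₎-1
InΓ-basis zero    (suc _) = InZ₍₃₎-0
InΓ-basis (suc _) zero    = InZ₍₃₎-0
InΓ-basis (suc k) (suc i) = InΓ-basis k i

module _ {n : ℕ} (G : Fin n → Fin n → ℚ) where

  InΓt-resp-≗ : ∀ {x y : Vecℚ n} → x ≗ y → InΓt G x → InΓt G y
  InΓt-resp-≗ x≗y (x∈Γ , x²∈3Z) =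
    (λ i → subst InZ₍₃₎ (x≗y i) (x∈Γ i)) , subst In3Z₍₃₎ (form-cong G x≗y x≗y) x²∈3Z

  InΓt-· : ∀ c (x : Vecℚ n) → InZ₍₃₎ c → InΓt G x → InΓt G (c · x)
  InΓt-· c x c∈Z (x∈Γ , x²∈3Z) =
    InΓ-· c x c∈Z x∈Γ ,
    subst In3Z₍₃₎ (sym (form-·-· G c x)) (In3Z₍₃₎-*ˡ (c * c) (InZ₍₃₎-* c c c∈Z c∈Z) x²∈3Z)

  3Z·Γ⊆Γt : ∀ c (x : Vecℚ n) → In3Z₍₃₎ c → InΓ x → InZ₍₃₎ (form G x x) → InΓt G (c · x)
  3Z·Γ⊆Γt c x c∈3Z x∈Γ x²∈Z = InΓ-· c x c∈Z x∈Γ ,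
    subst In3Z₍₃₎ (sym (form-·-· G c x)) (In3Z₍₃₎-*ʳ (form G x x) x²∈Z (In3Z₍₃₎-*ʳ c c∈Z c∈3Z))
    where c∈Z = In3Z₍₃₎⇒InZ₍₃₎ c∈3Z

  module _ (G-sym : ∀ i j → G i j ≡ G j i) (norm∈Z : ∀ γ → InΓ γ → InZ₍₃₎ (form G γ γ)) where

    form∈Z : ∀ x y → InΓ x → InΓ y → InZ₍₃₎ (form G x y)
    form∈Z x y x∈Γ y∈Γ = subst InZ₍₃₎ ½[s-p-q]≡b (InZ₍₃₎-* ½ (s - p - q) InZ₍₃₎-½ s-p-q∈Z)
      where
      open +-*-Solver
      s p q b : ℚ
      s = form G (x ⊕ y) (x ⊕ y)
      p = form G x x
      q = form G y y
      b = form G x y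
      s-p-q∈Z : InZ₍₃₎ (s - p - q)
      s-p-q∈Z = InZ₍₃₎-- (s - p) q
        (InZ₍₃₎-- s p (norm∈Z (x ⊕ y) (InΓ-⊕ x y x∈Γ y∈Γ)) (norm∈Z x x∈Γ)) (norm∈Z y y∈Γ)
      ½[s-p-q]≡b : ½ * (s - p - q) ≡ b
      ½[s-p-q]≡b = begin
        ½ * (s - p - q)                ≡⟨ cong (λ s → ½ * (s - p - q)) (form-⊕-⊕ G G-sym x y) ⟩
        ½ * (p + (b + b) + q - p - q)  ≡⟨ solve 4 (λ h p b q → h :* (p :+ (b :+ b) :+ q :- p :- q)
                                                       := h :* (con 1ℚ :+ con 1ℚ) :* b) refl ½ p b q ⟩
        ½ * (1ℚ + 1ℚ) * b              ≡⟨ ℚ.*-identityˡ b ⟩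
        b                              ∎

    module _ (disc∈3Z : ∀ α β → InΓ α → InΓ β →
                In3Z₍₃₎ (form G α β * form G α β - form G α α * form G β β)) where

      open +-*-Solver

      form∈3Z : ∀ x y → InΓt G x → InΓ y → In3Z₍₃₎ (form G x y)
      form∈3Z x y (x∈Γ , x²∈3Z) y∈Γ = In3Z₍₃₎-sq b (form∈Z x y x∈Γ y∈Γ) b²∈3Z
        where
        p q b : ℚ
        p = form G x x
        q = form G y y
        b = form G x y
        b²∈3Z : In3Z₍₃₎ (b * b)
        b²∈3Z = subst In3Z₍₃₎ (solve 3 (λ b p q → b :* b :- p :* q :+ p :* q := b :* b) refl b p q)
          (In3Z₍₃₎-+ (disc∈3Z x y x∈Γ y∈Γ) (In3Z₍₃₎-*ʳ q (norm∈Z y y∈Γ) x²∈3Z))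

      InΓt-⊕ : ∀ (x y : Vecℚ n) → InΓt G x → InΓt G y → InΓt G (x ⊕ y)
      InΓt-⊕ x y x∈Γt@(x∈Γ , x²∈3Z) (y∈Γ , y²∈3Z) = InΓ-⊕ x y x∈Γ y∈Γ ,
        subst In3Z₍₃₎ (sym (form-⊕-⊕ G G-sym x y)) (In3Z₍₃₎-+ (In3Z₍₃₎-+ x²∈3Z (In3Z₍₃₎-+ b∈3Z b∈3Z)) y²∈3Z)
        where b∈3Z = form∈3Z x y x∈Γt y∈Γ

      Γt-isSubmodule : IsSubmoduleΓt G
      Γt-isSubmodule = (InΓ-𝟎 , subst In3Z₍₃₎ (sym (form-𝟎ˡ G 𝟎)) In3Z₍₃₎-0) , InΓt-⊕ , InΓt-·

      basis⊆Γt⇒Γ⊆Γt : (∀ k → InΓt G (basis k)) → ∀ x → InΓ x → InΓt G x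
      basis⊆Γt⇒Γ⊆Γt basis∈Γt x x∈Γ = x∈Γ , In3Z₍₃₎-∑ n _ (λ i → In3Z₍₃₎-∑ n _ (λ j →
          In3Z₍₃₎-*ʳ (x j) (x∈Γ j) (In3Z₍₃₎-*ˡ (x i) (x∈Γ i) (G∈3Z i j))))
        where
        G∈3Z : ∀ i j → In3Z₍₃₎ (G i j)
        G∈3Z i j = subst In3Z₍₃₎ (form-basis G i j) (form∈3Z (basis i) (basis j) (basis∈Γt i) (InΓ-basis j))

      Γt-index-1 : (∀ k → InΓt G (basis k)) → HasIndex G 1
      Γt-index-1 basis∈Γt = (λ _ → 𝟎) , (λ _ → InΓ-𝟎) , cover , distinct
        where
        cover : ∀ x → InΓ x → ∃ λ i → InΓt G (x ⊖ 𝟎)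
        cover x x∈Γ = zero , basis⊆Γt⇒Γ⊆Γt basis∈Γt (x ⊖ 𝟎) (InΓ-⊖ x 𝟎 x∈Γ InΓ-𝟎)
        distinct : ∀ (i j : Fin 1) → InΓt G (𝟎 ⊖ 𝟎) → i ≡ j
        distinct zero zero _ = refl

      projection∈Γt : ∀ α → InΓ α → ¬ In3Z₍₃₎ (form G α α) →
        ∀ x → InΓ x → ∃ λ c → InZ₍₃₎ c × InΓt G (x ⊖ (c · α))
      projection∈Γt α α∈Γ q∉3Z x x∈Γ with InZ₍₃₎-inverse (form G α α) (norm∈Z α α∈Γ) q∉3Z
      ... | u , u∈Z , qu≡1 = c , c∈Z , v∈Γ , v²∈3Z
        where
        p q b c : ℚ
        p = form G x x
        q = form G α α
        b = form G x α
        c = b * u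
        v : Vecℚ n
        v = x ⊖ (c · α)
        c∈Z : InZ₍₃₎ c
        c∈Z = InZ₍₃₎-* b u (form∈Z x α x∈Γ α∈Γ) u∈Z
        cq≡b : c * q ≡ b
        cq≡b = begin
          b * u * q    ≡⟨ solve 3 (λ b u q → b :* u :* q := b :* (q :* u)) refl b u q ⟩
          b * (q * u)  ≡⟨ cong (b *_) qu≡1 ⟩
          b * 1ℚ       ≡⟨ ℚ.*-identityʳ b ⟩
          b            ∎
        v∈Γ : InΓ v
        v∈Γ = InΓ-⊖ x (c · α) x∈Γ (InΓ-· c α c∈Z α∈Γ)
        v²q∈3Z : In3Z₍₃₎ (form G v v * q)
        v²q∈3Z = subst In3Z₍₃₎
          (trans (solve 3 (λ b p q → :- (b :* b :- p :* q) := p :* q :- b :* b) refl b p q)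
                 (sym (form-projection G G-sym x α c cq≡b)))
          (In3Z₍₃₎-neg (disc∈3Z x α x∈Γ α∈Γ))
        v²∈3Z : In3Z₍₃₎ (form G v v)
        v²∈3Z = In3Z₍₃₎-cancelʳ (form G v v) q (norm∈Z v v∈Γ) (norm∈Z α α∈Γ) q∉3Z v²q∈3Z

      Γt-coset-residue : ∀ α → InΓ α → ∀ x c → InZ₍₃₎ c → InΓt G (x ⊖ (c · α)) →
        ∃ λ i → InΓt G (x ⊖ (residue₃ i · α))
      Γt-coset-residue α α∈Γ x c c∈Z x-cα∈Γt =
        let i , c-rᵢ∈3Z = residue₃-surjective c c∈Z in i , shift i c-rᵢ∈3Z
        where
        shift : ∀ i → In3Z₍₃₎ (c - residue₃ i) → InΓt G (x ⊖ (residue₃ i · α))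
        shift i d∈3Z = InΓt-resp-≗ sum≗x-rᵢα
          (InΓt-⊕ (x ⊖ (c · α)) (d · α) x-cα∈Γt (3Z·Γ⊆Γt d α d∈3Z α∈Γ (norm∈Z α α∈Γ)))
          where
          d : ℚ
          d = c - residue₃ i
          sum≗x-rᵢα : (x ⊖ (c · α)) ⊕ (d · α) ≗ x ⊖ (residue₃ i · α)
          sum≗x-rᵢα j = solve 4 (λ x c a r → x :- c :* a :+ (c :- r) :* a := x :- r :* a)
            refl (x j) c (α j) (residue₃ i)

      Γt-cosets-cover : ∀ α → InΓ α → ¬ In3Z₍₃₎ (form G α α) →
        ∀ x → InΓ x → ∃ λ i → InΓt G (x ⊖ (residue₃ i · α))
      Γt-cosets-cover α α∈Γ q∉3Z x x∈Γ =
        let c , c∈Z , x-cα∈Γt = projection∈Γt α α∈Γ q∉3Z x x∈Γ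
        in Γt-coset-residue α α∈Γ x c c∈Z x-cα∈Γt

      Γt-cosets-distinct : ∀ α → InΓ α → ¬ In3Z₍₃₎ (form G α α) →
        ∀ i j → InΓt G ((residue₃ i · α) ⊖ (residue₃ j · α)) → i ≡ j
      Γt-cosets-distinct α α∈Γ q∉3Z i j (_ , norm∈3Z) = residue₃-injective i j
        (In3Z₍₃₎-sq ε ε∈Z (In3Z₍₃₎-cancelʳ (ε * ε) q (InZ₍₃₎-* ε ε ε∈Z ε∈Z) (norm∈Z α α∈Γ) q∉3Z ε²q∈3Z))
        where
        ε q : ℚ
        ε = residue₃ i - residue₃ j
        q = form G α α
        ε∈Z : InZ₍₃₎ ε
        ε∈Z = InZ₍₃₎-- (residue₃ i) (residue₃ j) (InZ₍₃₎-residue₃ i) (InZ₍₃₎-residue₃ j)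
        difference≗εα : (residue₃ i · α) ⊖ (residue₃ j · α) ≗ ε · α
        difference≗εα k = solve 3 (λ r s a → r :* a :- s :* a := (r :- s) :* a)
          refl (residue₃ i) (residue₃ j) (α k)
        ε²q∈3Z : In3Z₍₃₎ (ε * ε * q)
        ε²q∈3Z = subst In3Z₍₃₎ (trans (form-cong G difference≗εα difference≗εα) (form-·-· G ε α)) norm∈3Z

      Γt-index-3 : ∀ α → InΓ α → ¬ In3Z₍₃₎ (form G α α) → HasIndex G 3
      Γt-index-3 α α∈Γ q∉3Z =
        (λ i → residue₃ i · α) ,
        (λ i → InΓ-· (residue₃ i) α (InZ₍₃₎-residue₃ i) α∈Γ) ,
        Γt-cosets-cover α α∈Γ q∉3Z ,
        Γt-cosets-distinct α α∈Γ q∉3Z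

lemma2p9 : (n : ℕ) (G : Fin n → Fin n → ℚ) →
    IsEuclideanGram n G →
    ((γ : Vecℚ n) → InΓ γ → InZ₍₃₎ (form G γ γ)) →
    ((α β : Vecℚ n) → InΓ α → InΓ β →
    In3Z₍₃₎ (form G α β * form G α β - form G α α * form G β β)) →
    IsSubmoduleΓt G × (HasIndex G 1 ⊎ HasIndex G 3)
lemma2p9 n G (G-sym , _) norm∈Z disc∈3Z = Γt-isSubmodule G G-sym norm∈Z disc∈3Z , index
  where
  basis∈Γt? : ∀ k → Dec (In3Z₍₃₎ (form G (basis k) (basis k)))
  basis∈Γt? k = In3Z₍₃₎? (form G (basis k) (basis k)) (norm∈Z (basis k) (InΓ-basis k))
  index : HasIndex G 1 ⊎ HasIndex G 3
  index with Fin.all? basis∈Γt?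
  ... | yes all∈3Z = inj₁ (Γt-index-1 G G-sym norm∈Z disc∈3Z (λ k → InΓ-basis k , all∈3Z k))
  ... | no ¬all∈3Z with Fin.¬∀⟶∃¬ n _ basis∈Γt? ¬all∈3Z
  ...   | k , k∉3Z = inj₂ (Γt-index-3 G G-sym norm∈Z disc∈3Z (basis k) (InΓ-basis k) k∉3Z)
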